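{- If $H$ is an elder graph with edges colored by $\{0,1,\ldots,k\}$ and $H'$ is a $0$-contraction of $H$, then $H'$ is an elder graph.
   Context: Directed graphs have no loops, parallel edges, or oppositely directed pairs; connectivity refers to the underlying undirected graph. Two vertices form a fork if they are distinct, non-adjacent, and have a common out-neighbor; an elder graph is a directed graph with no fork. $0$-contraction: for a directed graph $F'$ with edges colored by $\{0,\ldots,k\}$ and a partition $P$ of $V(F')$ such that each part induces a connected subgraph all of whose edges have color $0$, and for distinct parts $p_1,p_2$, $u,u'\in p_1$, $v,v'\in p_2$, if $(u,v)$ is an edge then $(v',u')$ is not an edge and if $(u',v')$ is an edge it has the same color as $(u,v)$; the $0$-contraction is the directed graph with vertex set $P$ in which $(p_1,p_2)$ is an edge iff $(v_1,v_2)\in E(F')$ for some $v_1\in p_1$, $v_2\in p_2$, colored as $(v_1,v_2)$. -}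

module Defs where

open import Data.Nat using (ℕ; suc)
open import Data.Fin using (Fin; zero)
open import Data.Product using (Σ; ∃; _×_; _,_)
open import Data.Sum using (_⊎_)
open import Relation.Nullary using (¬_)
open import Relation.Binary.PropositionalEquality using (_≡_; _≢_)

-- Using a relation, there is at most one edge
-- per ordered pair (no parallel edges).
IsDigraph : ∀ {n} → (Fin n → Fin n → Set) → Set
IsDigraph {n} E = (∀ (v : Fin n) → ¬ E v v) × (∀ (u v : Fin n) → E u v → ¬ E v u)

Fork : ∀ {n} → (Fin n → Fin n → Set) → Fin n → Fin n → Set
Fork {n} E u v =
  u ≢ v × ¬ E u v × ¬ E v u × ∃ λ (w : Fin n) → E u w × E v w

IsElder : ∀ {n} → (Fin n → Fin n → Set) → Set
IsElder {n} E = IsDigraph E × (∀ (u v : Fin n) → ¬ Fork E u v)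

-- A partition of Fin n into m parts is a surjection π : Fin n → Fin m
-- (part of v is π v; surjectivity = every part is nonempty).
Surjective : ∀ {n m} → (Fin n → Fin m) → Set
Surjective {n} {m} π = ∀ (p : Fin m) → ∃ λ (v : Fin n) → π v ≡ p

data PartWalk {n m} (E : Fin n → Fin n → Set) (π : Fin n → Fin m)
     : Fin n → Fin n → Set where
  here : ∀ {u} → PartWalk E π u u
  step : ∀ {u v w} → π v ≡ π u → (E u v ⊎ E v u) → PartWalk E π v w →
         PartWalk E π u w

-- An edge-colouring col by colours {0,…,k} (= Fin (suc k)); col u v is only
-- meaningful when E u v.
-- The partition π is admissible for 0-contraction (as in the paper).
Is0ContractionPartition : ∀ {n m k} (E : Fin n → Fin n → Set)
  (col : Fin n → Fin n → Fin (suc k)) (π : Fin n → Fin m) → Set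
Is0ContractionPartition {n} {m} {k} E col π =
  Surjective π
  × (∀ (u v : Fin n) → π u ≡ π v → PartWalk E π u v)
  × (∀ (u v : Fin n) → π u ≡ π v → E u v → col u v ≡ zero)
  × (∀ (u u' v v' : Fin n) → π u ≡ π u' → π v ≡ π v' → π u ≢ π v →
       E u v → ¬ E v' u' × (E u' v' → col u' v' ≡ col u v))

ContractEdge : ∀ {n m} (E : Fin n → Fin n → Set) (π : Fin n → Fin m) →
  Fin m → Fin m → Set
ContractEdge {n} E π p₁ p₂ =
  p₁ ≢ p₂ × ∃ λ (v₁ : Fin n) → ∃ λ (v₂ : Fin n) → π v₁ ≡ p₁ × π v₂ ≡ p₂ × E v₁ v₂

-- Colour of a contracted edge (as the colour of any underlying edge; well
-- defined by the partition conditions).  Not needed for the elder property.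

module Submission where

open import Defs
open import Data.Nat using (ℕ; suc)
open import Data.Fin using (Fin; _≟_)
open import Data.Product using (_,_; proj₁)
open import Data.Sum using (inj₁; inj₂)
open import Relation.Nullary using (¬_; yes; no)
open import Relation.Binary.PropositionalEquality using (_≡_; _≢_; refl; sym; trans; cong)

-- Idea: let p, q be a fork of the contraction with common out-neighbour r,
-- witnessed by edges a → w₁ and b → w₂ with a ∈ p, b ∈ q, w₁, w₂ ∈ r.
-- Call x ∈ r reachable if a → x₁ → ⋯ → x with all xᵢ ∈ r.  Since H has no
-- fork and edges between parts are consistently oriented, reachability
-- propagates along out-edges and (up to double negation) along in-edges
-- inside r; as r is connected, w₂ is reachable.  But a reachable
-- out-neighbour of b yields a fork in H, by induction along the path.

module _ {n m : ℕ} (E : Fin n → Fin n → Set) (π : Fin n → Fin m) where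

  OrientedBetweenParts : Set
  OrientedBetweenParts = ∀ (u u' v v' : Fin n) → π u ≡ π u' → π v ≡ π v' →
    π u ≢ π v → E u v → ¬ E v' u'

  data ReachIn (r : Fin m) (a : Fin n) : Fin n → Set where
    start  : ∀ {x} → π x ≡ r → E a x → ReachIn r a x
    extend : ∀ {x y} → ReachIn r a x → π y ≡ r → E x y → ReachIn r a y

ReachIn-part : ∀ {n m} {E : Fin n → Fin n → Set} {π : Fin n → Fin m} {r a x} →
  ReachIn E π r a x → π x ≡ r
ReachIn-part (start πx _)    = πx
ReachIn-part (extend _ πy _) = πy

module _ {n m : ℕ} {E : Fin n → Fin n → Set} {π : Fin n → Fin m}
    (oriented : OrientedBetweenParts E π) where

  ContractEdge-asymmetric : ∀ p q → ContractEdge E π p q → ¬ ContractEdge E π q p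
  ContractEdge-asymmetric p q (p≢q , a , b , πa , πb , a→b) (_ , c , d , πc , πd , c→d) =
    oriented a d b c (trans πa (sym πd)) (trans πb (sym πc))
      (λ eq → p≢q (trans (sym πa) (trans eq πb))) a→b c→d

  private
    outside≢inside : ∀ {r u v} → π u ≢ r → π v ≡ r → u ≢ v
    outside≢inside πu≢r πv≡r refl = πu≢r πv≡r

    noEdgeBack : ∀ {r u v v'} → π u ≢ r → π v ≡ r → π v' ≡ r →
                 E u v → ¬ E v' u
    noEdgeBack πu≢r πv≡r πv'≡r =
      oriented _ _ _ _ refl (trans πv≡r (sym πv'≡r)) (λ eq → πu≢r (trans eq πv≡r))

  module _ (forkFree : ∀ (u v : Fin n) → ¬ Fork E u v) where

    -- Only double-negated: E is not decidable, and the absence of forks only refutes.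
    ReachIn-inNeighbour : ∀ {r a x y} → π a ≢ r → ReachIn E π r a x →
      π y ≡ r → E y x → ¬ ¬ ReachIn E π r a y
    ReachIn-inNeighbour {y = y} πa≢r (start πx a→x) πy y→x ¬reach =
      forkFree _ y (outside≢inside πa≢r πy , (λ a→y → ¬reach (start πy a→y)) ,
                    noEdgeBack πa≢r πx πy a→x , (_ , a→x , y→x))
    ReachIn-inNeighbour {y = y} πa≢r (extend {z} reach πx z→x) πy y→x ¬reach
      with z ≟ y
    ... | yes refl = ¬reach reach
    ... | no z≢y =
      forkFree z y (z≢y , (λ z→y → ¬reach (extend reach πy z→y)) ,
                    (λ y→z → ReachIn-inNeighbour πa≢r reach πy y→z ¬reach) ,
                    (_ , z→x , y→x))

    ReachIn-walk : ∀ {r a x y} → π a ≢ r → PartWalk E π x y →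
      ReachIn E π r a x → ¬ ¬ ReachIn E π r a y
    ReachIn-walk πa≢r here reach ¬reach = ¬reach reach
    ReachIn-walk πa≢r (step πv (inj₁ x→v) walk) reach =
      ReachIn-walk πa≢r walk (extend reach (trans πv (ReachIn-part reach)) x→v)
    ReachIn-walk πa≢r (step πv (inj₂ v→x) walk) reach ¬reach =
      ReachIn-inNeighbour πa≢r reach (trans πv (ReachIn-part reach)) v→x
        (λ reach' → ReachIn-walk πa≢r walk reach' ¬reach)

    ReachIn-noCommonTarget : ∀ {r a b x} → a ≢ b → ¬ E a b → ¬ E b a →
      π b ≢ r → ReachIn E π r a x → ¬ E b x
    ReachIn-noCommonTarget a≢b ¬a→b ¬b→a πb≢r (start _ a→x) b→x =
      forkFree _ _ (a≢b , ¬a→b , ¬b→a , (_ , a→x , b→x))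
    ReachIn-noCommonTarget a≢b ¬a→b ¬b→a πb≢r (extend {z} reach πx z→x) b→x =
      forkFree _ z (outside≢inside πb≢r (ReachIn-part reach) ,
                    ReachIn-noCommonTarget a≢b ¬a→b ¬b→a πb≢r reach ,
                    noEdgeBack πb≢r πx (ReachIn-part reach) b→x ,
                    (_ , b→x , z→x))

    ContractEdge-forkFree : (∀ u v → π u ≡ π v → PartWalk E π u v) →
      ∀ p q → ¬ Fork (ContractEdge E π) p q
    ContractEdge-forkFree connected p q
      (p≢q , ¬p→q , ¬q→p , r , (p≢r , a , w₁ , πa , πw₁ , a→w₁)
                             , (q≢r , b , w₂ , πb , πw₂ , b→w₂)) =
      ReachIn-walk πa≢r (connected w₁ w₂ (trans πw₁ (sym πw₂))) (start πw₁ a→w₁)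
        (λ reach → ReachIn-noCommonTarget a≢b ¬a→b ¬b→a πb≢r reach b→w₂)
      where
      πa≢r : π a ≢ r
      πa≢r eq = p≢r (trans (sym πa) eq)
      πb≢r : π b ≢ r
      πb≢r eq = q≢r (trans (sym πb) eq)
      a≢b : a ≢ b
      a≢b eq = p≢q (trans (sym πa) (trans (cong π eq) πb))
      ¬a→b : ¬ E a b
      ¬a→b a→b = ¬p→q (p≢q , a , b , πa , πb , a→b)
      ¬b→a : ¬ E b a
      ¬b→a b→a = ¬q→p ((λ eq → p≢q (sym eq)) , b , a , πb , πa , b→a)

lemma12 : ∀ (n m k : ℕ) (E : Fin n → Fin n → Set)
    (col : Fin n → Fin n → Fin (suc k)) (π : Fin n → Fin m) →
    IsElder E → Is0ContractionPartition E col π →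
    IsElder (ContractEdge E π)
lemma12 n m k E col π (_ , forkFree) (_ , connected , _ , betweenParts) =
  ((λ p p→p → proj₁ p→p refl) , ContractEdge-asymmetric oriented) ,
  ContractEdge-forkFree oriented forkFree connected
  where
  oriented : OrientedBetweenParts E π
  oriented u u' v v' πu πv πu≢πv u→v = proj₁ (betweenParts u u' v v' πu πv πu≢πv u→v)
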